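{- For any finite field $F$ and any positive integer $n\leq 2$, the unitary Cayley graph $\Gamma(M_n(F))$ is well-covered.
   Context: $M_n(F)$ is the ring of $n\times n$ matrices over $F$. The unitary Cayley graph $\Gamma(R)$ of a finite ring $R$ has vertex set $R$, with distinct $x,y$ adjacent iff $x-y$ is a unit of $R$. A graph is well-covered if all its maximal independent sets have the same size. -}

module Defs where

open import Level using (Level; _⊔_)
open import Algebra.Bundles using (CommutativeRing)
open import Data.Nat using (ℕ; zero; suc)
open import Data.Fin using (Fin; zero; suc)
open import Data.Product using (Σ; ∃; _×_; _,_)
open import Data.List using (List; length; _∷_)
open import Data.List.Relation.Unary.AllPairs using (AllPairs)
open import Relation.Nullary using (¬_)
open import Relation.Binary.PropositionalEquality using (_≡_)

record IsField {c ℓ : Level} (R : CommutativeRing c ℓ) : Set (c ⊔ ℓ) where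
  open CommutativeRing R
  field
    0≉1     : ¬ (0# ≈ 1#)
    inverse : ∀ x → ¬ (x ≈ 0#) → Σ Carrier λ y → x * y ≈ 1#

record IsFinite {c ℓ : Level} (R : CommutativeRing c ℓ) : Set (c ⊔ ℓ) where
  open CommutativeRing R
  field
    size       : ℕ
    enum       : Fin size → Carrier
    index      : Carrier → Fin size
    enum-index : ∀ x → enum (index x) ≈ x
    index-enum : ∀ i → index (enum i) ≡ i
    index-cong : ∀ {x y} → x ≈ y → index x ≡ index y

module Matrices {c ℓ : Level} (R : CommutativeRing c ℓ) where
  open CommutativeRing R hiding (zero)

  Mat : ℕ → Set c
  Mat n = Fin n → Fin n → Carrier

  Σ[_] : (n : ℕ) → (Fin n → Carrier) → Carrier
  Σ[ zero ] f = 0#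
  Σ[ suc n ] f = f zero + Σ[ n ] (λ i → f (suc i))

  _≈M_ : {n : ℕ} → Mat n → Mat n → Set ℓ
  A ≈M B = ∀ i j → A i j ≈ B i j

  _-M_ : {n : ℕ} → Mat n → Mat n → Mat n
  (A -M B) i j = A i j - B i j

  _*M_ : {n : ℕ} → Mat n → Mat n → Mat n
  _*M_ {n} A B i j = Σ[ n ] (λ k → A i k * B k j)

  I : {n : ℕ} → Mat n
  I zero    zero    = 1#
  I zero    (suc j) = 0#
  I (suc i) zero    = 0#
  I (suc i) (suc j) = I i j

  IsUnit : {n : ℕ} → Mat n → Set (c ⊔ ℓ)
  IsUnit {n} A = Σ (Mat n) λ B → (A *M B) ≈M I × (B *M A) ≈M I

  -- Unitary Cayley graph Γ(M_n(R)): distinct x, y adjacent iff x - y is a unit.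
  Adjacent : {n : ℕ} → Mat n → Mat n → Set (c ⊔ ℓ)
  Adjacent x y = ¬ (x ≈M y) × IsUnit (x -M y)

  -- An independent set, represented as a list of pairwise distinct,
  -- pairwise non-adjacent vertices (its size is the length of the list).
  Independent : {n : ℕ} → List (Mat n) → Set (c ⊔ ℓ)
  Independent = AllPairs (λ x y → ¬ (x ≈M y) × ¬ IsUnit (x -M y))

  MaximalIndependent : {n : ℕ} → List (Mat n) → Set (c ⊔ ℓ)
  MaximalIndependent {n} S = Independent S × (∀ (v : Mat n) → ¬ Independent (v ∷ S))

  WellCovered : ℕ → Set (c ⊔ ℓ)
  WellCovered n = ∀ (S T : List (Mat n)) → MaximalIndependent S → MaximalIndependent T
                  → length S ≡ length T

-- For n = 1 the graph is complete, so a maximal independent set is a single vertex.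
-- For n = 2, translating a maximal independent set S by one of its members s₀ gives a
-- family of singular matrices with pairwise singular differences. Over a field such a
-- family lies in one of two kinds of planes: after permuting rows and columns so that a
-- nonzero member A has A₀₀ ≠ 0, either every member has its rows proportional to the
-- first row of A, or every member has its columns proportional to the first column of A.
-- Each such plane is a copy of F² all of whose differences are singular, so by
-- maximality S is the whole coset s₀ + plane, and |S| = |F|².

module Submission where

open import Defs
open import Level using (Level; _⊔_)
open import Algebra.Bundles using (CommutativeRing)
open import Algebra.Solver.Ring.AlmostCommutativeRing using (fromCommutativeRing; _-Raw-AlmostCommutative⟶_)
open import Data.Nat as ℕ using (ℕ; zero; suc; z≤n; s≤s; _≤_)
import Data.Nat.Properties as ℕ
open import Data.Integer as ℤ using (ℤ; +_; -[1+_])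
import Data.Integer.Properties as ℤ
import Data.Sign as Sign
open import Data.Fin as Fin using (Fin; zero; suc; combine; remQuot)
open import Data.Fin.Patterns using (0F; 1F)
open import Data.Fin.Properties using (cantor-schröder-bernstein; combine-injective; combine-remQuot)
open import Data.Maybe using (Maybe; just; nothing)
open import Data.Product using (Σ; ∃; ∃₂; _×_; _,_; proj₁; proj₂)
open import Data.Product.Relation.Binary.Pointwise.NonDependent using (×-setoid)
open import Data.Sum using (_⊎_; inj₁; inj₂)
open import Data.List using (List; []; _∷_; length; lookup; map)
open import Data.List.Properties using (length-map)
open import Data.List.Relation.Unary.All as All using (All; all?)
open import Data.List.Relation.Unary.All.Properties using (¬All⇒Any¬)
open import Data.List.Relation.Unary.Any as Any using (Any; any?; here; there)
open import Data.List.Relation.Unary.Any.Properties as Any using (lookup-index)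
open import Data.List.Relation.Unary.AllPairs using (AllPairs; []; _∷_)
import Data.List.Relation.Unary.AllPairs.Properties as AllPairs
open import Data.List.Membership.Propositional using (_∈_; find; lose)
open import Data.List.Membership.Propositional.Properties using (∈-lookup; ∈-map⁺; ∈-map⁻)
open import Function using (_∘_)
open import Relation.Binary.Bundles using (Setoid)
open import Relation.Binary.Definitions using (Decidable)
open import Relation.Binary.PropositionalEquality as ≡ using (_≡_)
open import Relation.Nullary using (¬_; Dec; yes; no; contradiction)
open import Relation.Nullary.Decidable using (_×-dec_)

-- The solver compares normal forms by computing with their coefficients, so these are
-- taken in ℤ and interpreted in R.
module IntegerCoefficientSolver {r ℓ : Level} (R : CommutativeRing r ℓ) where
  open CommutativeRing R hiding (zero)
  open import Algebra.Properties.Ring ring using (-0#≈0#; -‿involutive; -‿distribˡ-*; -‿distribʳ-*; -‿+-comm)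
  open import Algebra.Properties.Semiring.Mult semiring using (×-congˡ; ×-homo-+; ×1-homo-*)
    renaming (_×_ to _·_)
  open import Algebra.Properties.CommutativeSemigroup +-commutativeSemigroup using (interchange)
  open import Relation.Binary.Reasoning.Setoid setoid

  ⟦_⟧ℤ : ℤ → Carrier
  ⟦ + n ⟧ℤ      = n · 1#
  ⟦ -[1+ n ] ⟧ℤ = - (suc n · 1#)

  ⊖-homo : ∀ m n → ⟦ m ℤ.⊖ n ⟧ℤ ≈ m · 1# - n · 1#
  ⊖-homo m zero rewrite ℤ.⊖-≥ {m} {zero} z≤n = sym (trans (+-congˡ -0#≈0#) (+-identityʳ _))
  ⊖-homo zero (suc n) rewrite ℤ.⊖-≤ {zero} {suc n} z≤n = sym (+-identityˡ _)
  ⊖-homo (suc m) (suc n) rewrite ℤ.[1+m]⊖[1+n]≡m⊖n m n = begin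
    ⟦ m ℤ.⊖ n ⟧ℤ                           ≈⟨ ⊖-homo m n ⟩
    m · 1# - n · 1#                        ≈⟨ +-identityˡ _ ⟨
    0# + (m · 1# - n · 1#)                 ≈⟨ +-congʳ (-‿inverseʳ 1#) ⟨
    (1# - 1#) + (m · 1# - n · 1#)          ≈⟨ interchange _ _ _ _ ⟩
    (1# + m · 1#) + (- 1# - n · 1#)        ≈⟨ +-congˡ (-‿+-comm _ _) ⟩
    (1# + m · 1#) - (1# + n · 1#)          ∎

  +-homo : ∀ i j → ⟦ i ℤ.+ j ⟧ℤ ≈ ⟦ i ⟧ℤ + ⟦ j ⟧ℤ
  +-homo (+ m)    (+ n)    = ×-homo-+ 1# m n
  +-homo (+ m)    -[1+ n ] = ⊖-homo m (suc n)
  +-homo -[1+ m ] (+ n)    = trans (⊖-homo n (suc m)) (+-comm _ _)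
  +-homo -[1+ m ] -[1+ n ] = begin
    - (suc (suc (m ℕ.+ n)) · 1#)      ≈⟨ -‿cong (×-congˡ (≡.sym (ℕ.+-suc (suc m) n))) ⟩
    - ((suc m ℕ.+ suc n) · 1#)        ≈⟨ -‿cong (×-homo-+ 1# (suc m) (suc n)) ⟩
    - (suc m · 1# + suc n · 1#)       ≈⟨ -‿+-comm _ _ ⟨
    - (suc m · 1#) - suc n · 1#       ∎

  -‿homo : ∀ i → ⟦ ℤ.- i ⟧ℤ ≈ - ⟦ i ⟧ℤ
  -‿homo (+ zero)  = sym -0#≈0#
  -‿homo (+ suc n) = refl
  -‿homo -[1+ n ]  = sym (-‿involutive _)

  ◃⁺-homo : ∀ n → ⟦ Sign.+ ℤ.◃ n ⟧ℤ ≈ n · 1#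
  ◃⁺-homo zero    = refl
  ◃⁺-homo (suc n) = refl

  ◃⁻-homo : ∀ n → ⟦ Sign.- ℤ.◃ n ⟧ℤ ≈ - (n · 1#)
  ◃⁻-homo zero    = sym -0#≈0#
  ◃⁻-homo (suc n) = refl

  *-homo : ∀ i j → ⟦ i ℤ.* j ⟧ℤ ≈ ⟦ i ⟧ℤ * ⟦ j ⟧ℤ
  *-homo (+ m) (+ n) = trans (◃⁺-homo (m ℕ.* n)) (×1-homo-* m n)
  *-homo (+ m) -[1+ n ] = begin
    ⟦ Sign.- ℤ.◃ (m ℕ.* suc n) ⟧ℤ     ≈⟨ ◃⁻-homo (m ℕ.* suc n) ⟩
    - ((m ℕ.* suc n) · 1#)            ≈⟨ -‿cong (×1-homo-* m (suc n)) ⟩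
    - (m · 1# * (suc n · 1#))         ≈⟨ -‿distribʳ-* _ _ ⟩
    m · 1# * - (suc n · 1#)           ∎
  *-homo -[1+ m ] (+ n) = begin
    ⟦ Sign.- ℤ.◃ (suc m ℕ.* n) ⟧ℤ     ≈⟨ ◃⁻-homo (suc m ℕ.* n) ⟩
    - ((suc m ℕ.* n) · 1#)            ≈⟨ -‿cong (×1-homo-* (suc m) n) ⟩
    - (suc m · 1# * (n · 1#))         ≈⟨ -‿distribˡ-* _ _ ⟩
    - (suc m · 1#) * (n · 1#)         ∎
  *-homo -[1+ m ] -[1+ n ] = begin
    ⟦ Sign.+ ℤ.◃ (suc m ℕ.* suc n) ⟧ℤ ≈⟨ ◃⁺-homo (suc m ℕ.* suc n) ⟩
    (suc m ℕ.* suc n) · 1#            ≈⟨ ×1-homo-* (suc m) (suc n) ⟩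
    suc m · 1# * (suc n · 1#)         ≈⟨ -‿involutive _ ⟨
    - - (suc m · 1# * (suc n · 1#))   ≈⟨ -‿cong (-‿distribʳ-* _ _) ⟩
    - (suc m · 1# * - (suc n · 1#))   ≈⟨ -‿distribˡ-* _ _ ⟩
    - (suc m · 1#) * - (suc n · 1#)   ∎

  ℤ⟶R : ℤ.+-*-rawRing -Raw-AlmostCommutative⟶ fromCommutativeRing R
  ℤ⟶R = record
    { ⟦_⟧    = ⟦_⟧ℤ
    ; +-homo = +-homo
    ; *-homo = *-homo
    ; -‿homo = -‿homo
    ; 0-homo = refl
    ; 1-homo = +-identityʳ 1#
    }

  ≟-image : ∀ i j → Maybe (⟦ i ⟧ℤ ≈ ⟦ j ⟧ℤ)
  ≟-image i j with i ℤ.≟ j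
  ... | yes ≡.refl = just refl
  ... | no _       = nothing

  open import Algebra.Solver.Ring ℤ.+-*-rawRing (fromCommutativeRing R) ℤ⟶R ≟-image public

module _ {a ℓ : Level} (S : Setoid a ℓ) where
  open Setoid S
  open import Data.List.Membership.Setoid S using () renaming (_∈_ to _∈ₛ_)
  open import Data.List.Relation.Unary.Unique.Setoid S using (Unique)

  Unique-lookup-injective : ∀ {xs} → Unique xs → ∀ {i j} → lookup xs i ≈ lookup xs j → i ≡ j
  Unique-lookup-injective (_ ∷ _)      {zero}  {zero}  _ = ≡.refl
  Unique-lookup-injective (x≉xs ∷ _)   {zero}  {suc j} e = contradiction e (All.lookup x≉xs (∈-lookup j))
  Unique-lookup-injective (x≉xs ∷ _)   {suc i} {zero}  e = contradiction (sym e) (All.lookup x≉xs (∈-lookup i))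
  Unique-lookup-injective (_ ∷ unique) {suc i} {suc j} e = ≡.cong suc (Unique-lookup-injective unique e)

  length-unique-cover : ∀ {m} (code : Carrier → Fin m) (decode : Fin m → Carrier)
    → (∀ {x y} → code x ≡ code y → x ≈ y) → (∀ {i j} → decode i ≈ decode j → i ≡ j)
    → ∀ {xs} → Unique xs → (∀ x → x ∈ₛ xs) → length xs ≡ m
  length-unique-cover code decode code-injective decode-injective {xs} unique covers =
    cantor-schröder-bernstein position-injective occurrence-injective
    where
    occurrence : Fin _ → Fin (length xs)
    occurrence k = Any.index (covers (decode k))

    occurrence-injective : ∀ {k l} → occurrence k ≡ occurrence l → k ≡ l
    occurrence-injective {k} {l} e = decode-injective (trans (lookup-index (covers (decode k)))
      (trans (reflexive (≡.cong (lookup xs) e)) (sym (lookup-index (covers (decode l))))))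

    position-injective : ∀ {i j} → code (lookup xs i) ≡ code (lookup xs j) → i ≡ j
    position-injective e = Unique-lookup-injective unique (code-injective e)

module _ {a r : Level} {A : Set a} {R : A → A → Set r} where

  AllPairs-∈ : ∀ {xs x y} → AllPairs R xs → x ∈ xs → y ∈ xs → x ≡ y ⊎ R x y ⊎ R y x
  AllPairs-∈ (_ ∷ _)     (here ≡.refl) (here ≡.refl) = inj₁ ≡.refl
  AllPairs-∈ (Rx ∷ _)    (here ≡.refl) (there y∈)    = inj₂ (inj₁ (All.lookup Rx y∈))
  AllPairs-∈ (Rx ∷ _)    (there x∈)    (here ≡.refl) = inj₂ (inj₂ (All.lookup Rx x∈))
  AllPairs-∈ (_ ∷ pairs) (there x∈)    (there y∈)    = AllPairs-∈ pairs x∈ y∈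

  AllPairs-mapWithin : ∀ {s} {S : A → A → Set s} {xs} → (∀ {x y} → x ∈ xs → y ∈ xs → R x y → S x y)
                     → AllPairs R xs → AllPairs S xs
  AllPairs-mapWithin h []          = []
  AllPairs-mapWithin h (Rx ∷ pairs) =
    All.tabulate (λ y∈ → h (here ≡.refl) (there y∈) (All.lookup Rx y∈))
    ∷ AllPairs-mapWithin (λ x∈ y∈ → h (there x∈) (there y∈)) pairs

module VanishingCombinations {r ℓ : Level} (R : CommutativeRing r ℓ) where
  open CommutativeRing R
  open import Algebra.Properties.Ring ring using (-0#≈0#)

  ≈0-negate : ∀ {u} → u ≈ 0# → - u ≈ 0#
  ≈0-negate u≈0 = trans (-‿cong u≈0) -0#≈0#

  x≈y⇒x-y≈0 : ∀ {x y} → x ≈ y → x - y ≈ 0#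
  x≈y⇒x-y≈0 {y = y} x≈y = trans (+-congʳ x≈y) (-‿inverseʳ y)

  x-y≈0⇒x≈y : ∀ {x y} → x - y ≈ 0# → x ≈ y
  x-y≈0⇒x≈y {x} {y} x-y≈0 = begin
    x              ≈⟨ +-identityʳ x ⟨
    x + 0#         ≈⟨ +-congˡ (-‿inverseˡ y) ⟨
    x + (- y + y)  ≈⟨ +-assoc x (- y) y ⟨
    x - y + y      ≈⟨ +-congʳ x-y≈0 ⟩
    0# + y         ≈⟨ +-identityˡ y ⟩
    y              ∎
    where open import Relation.Binary.Reasoning.Setoid setoid

  ≈0-scale : ∀ {k u} → u ≈ 0# → k * u ≈ 0#
  ≈0-scale {k} u≈0 = trans (*-congˡ u≈0) (zeroʳ k)

  infixl 6 _+≈0_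
  _+≈0_ : ∀ {s k u} → s ≈ 0# → u ≈ 0# → s + k * u ≈ 0#
  s≈0 +≈0 u≈0 = trans (+-cong s≈0 (≈0-scale u≈0)) (+-identityʳ 0#)

module TwoByTwo {r ℓ : Level} (R : CommutativeRing r ℓ) where
  open CommutativeRing R hiding (zero)
  open Matrices R
  open IntegerCoefficientSolver R using (solve; _:=_; _:+_; _:*_; _:-_; :-_; con)
  open VanishingCombinations R

  mat : Carrier → Carrier → Carrier → Carrier → Mat 2
  mat a b c d 0F 0F = a
  mat a b c d 0F 1F = b
  mat a b c d 1F 0F = c
  mat a b c d 1F 1F = d

  ≈M-from-entries : ∀ {A B : Mat 2} → A 0F 0F ≈ B 0F 0F → A 0F 1F ≈ B 0F 1F
                  → A 1F 0F ≈ B 1F 0F → A 1F 1F ≈ B 1F 1F → A ≈M B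
  ≈M-from-entries e₀₀ e₀₁ e₁₀ e₁₁ 0F 0F = e₀₀
  ≈M-from-entries e₀₀ e₀₁ e₁₀ e₁₁ 0F 1F = e₀₁
  ≈M-from-entries e₀₀ e₀₁ e₁₀ e₁₁ 1F 0F = e₁₀
  ≈M-from-entries e₀₀ e₀₁ e₁₀ e₁₁ 1F 1F = e₁₁

  ≈M-sym : ∀ {n} {A B : Mat n} → A ≈M B → B ≈M A
  ≈M-sym e i j = sym (e i j)

  ≈M-trans : ∀ {n} {A B C : Mat n} → A ≈M B → B ≈M C → A ≈M C
  ≈M-trans e f i j = trans (e i j) (f i j)

  -M-cong : ∀ {n} {A A′ B B′ : Mat n} → A ≈M A′ → B ≈M B′ → (A -M B) ≈M (A′ -M B′)
  -M-cong e f i j = +-cong (e i j) (-‿cong (f i j))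

  -M-cancelʳ : ∀ {n} (A B C : Mat n) → ((A -M C) -M (B -M C)) ≈M (A -M B)
  -M-cancelʳ A B C i j = cancel (A i j) (B i j) (C i j)
    where
    cancel : ∀ u v w → (u - w) - (v - w) ≈ u - v
    cancel = solve 3 (λ u v w → (u :- w) :- (v :- w) := u :- v) refl

  -M-injectiveˡ : ∀ {n} {A B C : Mat n} → (A -M C) ≈M (B -M C) → A ≈M B
  -M-injectiveˡ {A = A} {B} {C} e i j =
    trans (restore (A i j) (C i j)) (trans (+-congʳ (e i j)) (sym (restore (B i j) (C i j))))
    where
    restore : ∀ u v → u ≈ (u - v) + v
    restore = solve 2 (λ u v → u := (u :- v) :+ v) refl

  det : Mat 2 → Carrier
  det M = M 0F 0F * M 1F 1F - M 0F 1F * M 1F 0F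

  Singular : Mat 2 → Set ℓ
  Singular M = det M ≈ 0#

  det-cong : ∀ {A B} → A ≈M B → det A ≈ det B
  det-cong e = +-cong (*-cong (e 0F 0F) (e 1F 1F)) (-‿cong (*-cong (e 0F 1F) (e 1F 0F)))

  det-*M : ∀ A B → det (A *M B) ≈ det A * det B
  det-*M A B = identity (A 0F 0F) (A 0F 1F) (A 1F 0F) (A 1F 1F) (B 0F 0F) (B 0F 1F) (B 1F 0F) (B 1F 1F)
    where
    identity : ∀ a b c d e f g h →
      (a * e + (b * g + 0#)) * (c * f + (d * h + 0#)) - (a * f + (b * h + 0#)) * (c * e + (d * g + 0#))
        ≈ (a * d - b * c) * (e * h - f * g)
    identity = solve 8 (λ a b c d e f g h →
      (a :* e :+ (b :* g :+ con (+ 0))) :* (c :* f :+ (d :* h :+ con (+ 0)))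
        :- (a :* f :+ (b :* h :+ con (+ 0))) :* (c :* e :+ (d :* g :+ con (+ 0)))
        := (a :* d :- b :* c) :* (e :* h :- f :* g)) refl

  det-I : det I ≈ 1#
  det-I = trans (+-cong (*-identityʳ 1#) (≈0-negate (zeroˡ 0#))) (+-identityʳ 1#)

  det-sub-comm : ∀ A B → det (A -M B) ≈ det (B -M A)
  det-sub-comm A B = identity (A 0F 0F) (A 0F 1F) (A 1F 0F) (A 1F 1F) (B 0F 0F) (B 0F 1F) (B 1F 0F) (B 1F 1F)
    where
    identity : ∀ a b c d a′ b′ c′ d′ →
      (a - a′) * (d - d′) - (b - b′) * (c - c′) ≈ (a′ - a) * (d′ - d) - (b′ - b) * (c′ - c)
    identity = solve 8 (λ a b c d a′ b′ c′ d′ →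
      (a :- a′) :* (d :- d′) :- (b :- b′) :* (c :- c′) := (a′ :- a) :* (d′ :- d) :- (b′ :- b) :* (c′ :- c)) refl

  Singular-sub-self : ∀ A → Singular (A -M A)
  Singular-sub-self A = identity (A 0F 0F) (A 0F 1F) (A 1F 0F) (A 1F 1F)
    where
    identity : ∀ a b c d → (a - a) * (d - d) - (b - b) * (c - c) ≈ 0#
    identity = solve 4 (λ a b c d → (a :- a) :* (d :- d) :- (b :- b) :* (c :- c) := con (+ 0)) refl

  permute : Fin 2 → Fin 2 → Fin 2
  permute 0F i  = i
  permute 1F 0F = 1F
  permute 1F 1F = 0F

  permute-involutive : ∀ p i → permute p (permute p i) ≡ i
  permute-involutive 0F i  = ≡.refl
  permute-involutive 1F 0F = ≡.refl
  permute-involutive 1F 1F = ≡.refl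

  reindex : Fin 2 → Fin 2 → Mat 2 → Mat 2
  reindex p q M i j = M (permute p i) (permute q j)

  reindex-involutive : ∀ p q M → reindex p q (reindex p q M) ≈M M
  reindex-involutive p q M i j rewrite permute-involutive p i | permute-involutive q j = refl

  reindex-cong : ∀ p q {A B} → A ≈M B → reindex p q A ≈M reindex p q B
  reindex-cong p q e i j = e (permute p i) (permute q j)

  Singular-reindex : ∀ p q M → Singular M → Singular (reindex p q M)
  Singular-reindex 0F 0F M det≈0 = det≈0
  Singular-reindex 0F 1F M det≈0 = trans (swapped (M 0F 0F) (M 0F 1F) (M 1F 0F) (M 1F 1F)) (≈0-negate det≈0)
    where
    swapped : ∀ a b c d → b * c - a * d ≈ - (a * d - b * c)
    swapped = solve 4 (λ a b c d → b :* c :- a :* d := :- (a :* d :- b :* c)) refl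
  Singular-reindex 1F 0F M det≈0 = trans (swapped (M 0F 0F) (M 0F 1F) (M 1F 0F) (M 1F 1F)) (≈0-negate det≈0)
    where
    swapped : ∀ a b c d → c * b - d * a ≈ - (a * d - b * c)
    swapped = solve 4 (λ a b c d → c :* b :- d :* a := :- (a :* d :- b :* c)) refl
  Singular-reindex 1F 1F M det≈0 = trans (swapped (M 0F 0F) (M 0F 1F) (M 1F 0F) (M 1F 1F)) det≈0
    where
    swapped : ∀ a b c d → d * a - c * b ≈ a * d - b * c
    swapped = solve 4 (λ a b c d → d :* a :- c :* b := a :* d :- b :* c) refl

  Coordinates : Setoid r ℓ
  Coordinates = ×-setoid setoid setoid

  open Setoid Coordinates public using ()
    renaming (_≈_ to _≈₂_; sym to ≈₂-sym; trans to ≈₂-trans)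
  open import Data.List.Membership.Setoid Coordinates public using () renaming (_∈_ to _∈₂_)
  open import Data.List.Relation.Unary.Unique.Setoid Coordinates public using (Unique)

  record SingularPlane : Set (r ⊔ ℓ) where
    field
      point              : Carrier × Carrier → Mat 2
      coords             : Mat 2 → Carrier × Carrier
      point-cong         : ∀ {u v} → u ≈₂ v → point u ≈M point v
      coords-cong        : ∀ {M N} → M ≈M N → coords M ≈₂ coords N
      coords-point       : ∀ u → coords (point u) ≈₂ u
      point-sub-singular : ∀ u v → Singular (point u -M point v)

    Contains : Mat 2 → Set ℓ
    Contains M = M ≈M point (coords M)

  open SingularPlane

  rowPlane : Carrier → SingularPlane
  rowPlane k = record
    { point              = λ (s , t) → mat s (s * k) t (t * k)
    ; coords             = λ M → M 0F 0F , M 1F 0F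
    ; point-cong         = λ (e , f) → ≈M-from-entries e (*-congʳ e) f (*-congʳ f)
    ; coords-cong        = λ e → e 0F 0F , e 1F 0F
    ; coords-point       = λ _ → refl , refl
    ; point-sub-singular = λ (s , t) (s′ , t′) → identity s t s′ t′ k
    }
    where
    identity : ∀ s t s′ t′ k → (s - s′) * (t * k - t′ * k) - (s * k - s′ * k) * (t - t′) ≈ 0#
    identity = solve 5 (λ s t s′ t′ k →
      (s :- s′) :* (t :* k :- t′ :* k) :- (s :* k :- s′ :* k) :* (t :- t′) := con (+ 0)) refl

  columnPlane : Carrier → SingularPlane
  columnPlane k = record
    { point              = λ (s , t) → mat s t (s * k) (t * k)
    ; coords             = λ M → M 0F 0F , M 0F 1F
    ; point-cong         = λ (e , f) → ≈M-from-entries e f (*-congʳ e) (*-congʳ f)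
    ; coords-cong        = λ e → e 0F 0F , e 0F 1F
    ; coords-point       = λ _ → refl , refl
    ; point-sub-singular = λ (s , t) (s′ , t′) → identity s t s′ t′ k
    }
    where
    identity : ∀ s t s′ t′ k → (s - s′) * (t * k - t′ * k) - (t - t′) * (s * k - s′ * k) ≈ 0#
    identity = solve 5 (λ s t s′ t′ k →
      (s :- s′) :* (t :* k :- t′ :* k) :- (t :- t′) :* (s :* k :- s′ :* k) := con (+ 0)) refl

  reindexPlane : Fin 2 → Fin 2 → SingularPlane → SingularPlane
  reindexPlane p q P = record
    { point              = λ u → reindex p q (point P u)
    ; coords             = λ M → coords P (reindex p q M)
    ; point-cong         = λ e → reindex-cong p q (point-cong P e)
    ; coords-cong        = λ e → coords-cong P (reindex-cong p q e)
    ; coords-point       = λ u → ≈₂-trans (coords-cong P (reindex-involutive p q (point P u))) (coords-point P u)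
    ; point-sub-singular = λ u v → Singular-reindex p q (point P u -M point P v) (point-sub-singular P u v)
    }

  Contains-reindexPlane : ∀ p q P {M} → Contains P (reindex p q M) → Contains (reindexPlane p q P) M
  Contains-reindexPlane p q P {M} m = ≈M-trans (≈M-sym (reindex-involutive p q M)) (reindex-cong p q m)

  0M : Mat 2
  0M _ _ = 0#

  _∥_ : Carrier × Carrier → Carrier × Carrier → Set ℓ
  (x , y) ∥ (a , b) = y * a - x * b ≈ 0#

  row column : Fin 2 → Mat 2 → Carrier × Carrier
  row i M    = M i 0F , M i 1F
  column j M = M 0F j , M 1F j

  RowsParallel ColumnsParallel : Mat 2 → Mat 2 → Set ℓ
  RowsParallel A X    = row 0F X ∥ row 0F A × row 1F X ∥ row 0F A
  ColumnsParallel A X = column 0F X ∥ column 0F A × column 1F X ∥ column 0F A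

  ∥⇒proportional : ∀ {x m a b e} → (x , m) ∥ (a , b) → a * e ≈ 1# → m ≈ x * (b * e)
  ∥⇒proportional {x} {m} {a} {b} {e} parallel ae≈1 = begin
    m                                                      ≈⟨ *-identityʳ m ⟨
    m * 1#                                                 ≈⟨ identity m x a b e 1# ⟩
    x * (b * e) + (e * (m * a - x * b) + m * (1# - a * e)) ≈⟨ +-congˡ vanishing ⟩
    x * (b * e) + 0#                                       ≈⟨ +-identityʳ _ ⟩
    x * (b * e)                                            ∎
    where
    open import Relation.Binary.Reasoning.Setoid setoid
    vanishing : e * (m * a - x * b) + m * (1# - a * e) ≈ 0#
    vanishing = ≈0-scale parallel +≈0 x≈y⇒x-y≈0 (sym ae≈1)
    identity : ∀ m x a b e one → m * one ≈ x * (b * e) + (e * (m * a - x * b) + m * (one - a * e))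
    identity = solve 6 (λ m x a b e one →
      m :* one := x :* (b :* e) :+ (e :* (m :* a :- x :* b) :+ m :* (one :- a :* e))) refl

  RowsParallel⇒Contains : ∀ A X {e} → A 0F 0F * e ≈ 1# → RowsParallel A X
                        → Contains (rowPlane (A 0F 1F * e)) X
  RowsParallel⇒Contains A X ae≈1 (first-row , second-row) =
    ≈M-from-entries refl (∥⇒proportional first-row ae≈1) refl (∥⇒proportional second-row ae≈1)

  ColumnsParallel⇒Contains : ∀ A X {e} → A 0F 0F * e ≈ 1# → ColumnsParallel A X
                           → Contains (columnPlane (A 1F 0F * e)) X
  ColumnsParallel⇒Contains A X ae≈1 (first-column , second-column) =
    ≈M-from-entries refl refl (∥⇒proportional first-column ae≈1) (∥⇒proportional second-column ae≈1)

  ≈0M⇒Contains : ∀ {X} → X ≈M 0M → Contains (rowPlane 0#) X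
  ≈0M⇒Contains X≈0 =
    ≈M-from-entries refl (trans (X≈0 0F 1F) (sym (zeroʳ _))) refl (trans (X≈0 1F 1F) (sym (zeroʳ _)))

  AllSingular PairwiseSingular : List (Mat 2) → Set (r ⊔ ℓ)
  AllSingular T      = ∀ {X} → X ∈ T → Singular X
  PairwiseSingular T = ∀ {X Y} → X ∈ T → Y ∈ T → Singular (X -M Y)

  InPlane : List (Mat 2) → Set (r ⊔ ℓ)
  InPlane T = Σ SingularPlane λ P → ∀ {X} → X ∈ T → Contains P X

  AllSingular-reindex : ∀ p q {T} → AllSingular T → AllSingular (map (reindex p q) T)
  AllSingular-reindex p q singular Y∈ with ∈-map⁻ (reindex p q) Y∈
  ... | X , X∈T , ≡.refl = Singular-reindex p q X (singular X∈T)

  PairwiseSingular-reindex : ∀ p q {T} → PairwiseSingular T → PairwiseSingular (map (reindex p q) T)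
  PairwiseSingular-reindex p q pairwise Y∈ Y′∈ with ∈-map⁻ (reindex p q) Y∈ | ∈-map⁻ (reindex p q) Y′∈
  ... | X , X∈T , ≡.refl | X′ , X′∈T , ≡.refl = Singular-reindex p q (X -M X′) (pairwise X∈T X′∈T)

  AllSingular-translate : ∀ {S C} → C ∈ S → PairwiseSingular S → AllSingular (map (_-M C) S)
  AllSingular-translate C∈S pairwise Y∈ with ∈-map⁻ _ Y∈
  ... | X , X∈S , ≡.refl = pairwise X∈S C∈S

  PairwiseSingular-translate : ∀ {S} C → PairwiseSingular S → PairwiseSingular (map (_-M C) S)
  PairwiseSingular-translate C pairwise Y∈ Y′∈ with ∈-map⁻ _ Y∈ | ∈-map⁻ _ Y′∈
  ... | X , X∈S , ≡.refl | X′ , X′∈S , ≡.refl = trans (det-cong (-M-cancelʳ X X′ C)) (pairwise X∈S X′∈S)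

  coordinates : SingularPlane → Mat 2 → Mat 2 → Carrier × Carrier
  coordinates P s₀ x = coords P (x -M s₀)

  Independent⇒Unique-coordinates : ∀ P s₀ {S} → (∀ {x} → x ∈ S → Contains P (x -M s₀))
                                 → Independent S → Unique (map (coordinates P s₀) S)
  Independent⇒Unique-coordinates P s₀ contains independent = AllPairs.map⁺ (AllPairs-mapWithin distinct independent)
    where
    distinct : ∀ {x y} → x ∈ _ → y ∈ _ → ¬ x ≈M y × ¬ IsUnit (x -M y)
             → ¬ coordinates P s₀ x ≈₂ coordinates P s₀ y
    distinct x∈S y∈S (x≉y , _) same = x≉y (-M-injectiveˡ
      (≈M-trans (contains x∈S) (≈M-trans (point-cong P same) (≈M-sym (contains y∈S)))))

module FieldProperties {r ℓ : Level} (F : CommutativeRing r ℓ) (isField : IsField F) where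
  open CommutativeRing F hiding (zero)
  open IsField isField
  open Matrices F
  open TwoByTwo F
  open VanishingCombinations F
  open IntegerCoefficientSolver F using (solve; _:=_; _:+_; _:*_; _:-_; :-_; con)

  x*y≈0⇒y≈0 : ∀ {x y} → ¬ x ≈ 0# → x * y ≈ 0# → y ≈ 0#
  x*y≈0⇒y≈0 {x} {y} x≉0 xy≈0 = begin
    y                                   ≈⟨ *-identityʳ y ⟨
    y * 1#                              ≈⟨ identity x y x⁻¹ 1# ⟩
    x⁻¹ * (x * y) + y * (1# - x * x⁻¹)  ≈⟨ ≈0-scale xy≈0 +≈0 x≈y⇒x-y≈0 (sym xx⁻¹≈1) ⟩
    0#                                  ∎
    where
    open import Relation.Binary.Reasoning.Setoid setoid
    x⁻¹ : Carrier
    x⁻¹ = proj₁ (inverse x x≉0)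
    xx⁻¹≈1 : x * x⁻¹ ≈ 1#
    xx⁻¹≈1 = proj₂ (inverse x x≉0)
    identity : ∀ x y x⁻¹ one → y * one ≈ x⁻¹ * (x * y) + y * (one - x * x⁻¹)
    identity = solve 4 (λ x y x⁻¹ one → y :* one := x⁻¹ :* (x :* y) :+ y :* (one :- x :* x⁻¹)) refl

  x≉0∧y≉0⇒x*y≉0 : ∀ {x y} → ¬ x ≈ 0# → ¬ y ≈ 0# → ¬ x * y ≈ 0#
  x≉0∧y≉0⇒x*y≉0 x≉0 y≉0 xy≈0 = y≉0 (x*y≈0⇒y≈0 x≉0 xy≈0)

  IsUnit⇒¬Singular : ∀ {A} → IsUnit A → ¬ Singular A
  IsUnit⇒¬Singular {A} (B , AB≈I , _) det≈0 = 0≉1 (begin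
    0#              ≈⟨ zeroˡ (det B) ⟨
    0# * det B      ≈⟨ *-congʳ det≈0 ⟨
    det A * det B   ≈⟨ det-*M A B ⟨
    det (A *M B)    ≈⟨ det-cong AB≈I ⟩
    det I           ≈⟨ det-I ⟩
    1#              ∎)
    where open import Relation.Binary.Reasoning.Setoid setoid

  ¬Singular⇒IsUnit : ∀ {A} → ¬ Singular A → IsUnit A
  ¬Singular⇒IsUnit {A} det≉0 = adjugate , AB≈I , BA≈I
    where
    a b c d δ⁻¹ : Carrier
    a = A 0F 0F ; b = A 0F 1F ; c = A 1F 0F ; d = A 1F 1F
    δ⁻¹ = proj₁ (inverse (det A) det≉0)
    δδ⁻¹≈1 : det A * δ⁻¹ ≈ 1#
    δδ⁻¹≈1 = proj₂ (inverse (det A) det≉0)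

    adjugate : Mat 2
    adjugate = mat (d * δ⁻¹) (- b * δ⁻¹) (- c * δ⁻¹) (a * δ⁻¹)

    AB≈I : (A *M adjugate) ≈M I
    AB≈I = ≈M-from-entries (trans (id₀₀ a b c d δ⁻¹) δδ⁻¹≈1) (id₀₁ a b c d δ⁻¹)
                           (id₁₀ a b c d δ⁻¹) (trans (id₁₁ a b c d δ⁻¹) δδ⁻¹≈1)
      where
      id₀₀ : ∀ a b c d e → a * (d * e) + (b * (- c * e) + 0#) ≈ (a * d - b * c) * e
      id₀₀ = solve 5 (λ a b c d e → a :* (d :* e) :+ (b :* (:- c :* e) :+ con (+ 0)) := (a :* d :- b :* c) :* e) refl
      id₀₁ : ∀ a b c d e → a * (- b * e) + (b * (a * e) + 0#) ≈ 0#
      id₀₁ = solve 5 (λ a b c d e → a :* (:- b :* e) :+ (b :* (a :* e) :+ con (+ 0)) := con (+ 0)) refl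
      id₁₀ : ∀ a b c d e → c * (d * e) + (d * (- c * e) + 0#) ≈ 0#
      id₁₀ = solve 5 (λ a b c d e → c :* (d :* e) :+ (d :* (:- c :* e) :+ con (+ 0)) := con (+ 0)) refl
      id₁₁ : ∀ a b c d e → c * (- b * e) + (d * (a * e) + 0#) ≈ (a * d - b * c) * e
      id₁₁ = solve 5 (λ a b c d e → c :* (:- b :* e) :+ (d :* (a :* e) :+ con (+ 0)) := (a :* d :- b :* c) :* e) refl

    BA≈I : (adjugate *M A) ≈M I
    BA≈I = ≈M-from-entries (trans (id₀₀ a b c d δ⁻¹) δδ⁻¹≈1) (id₀₁ a b c d δ⁻¹)
                           (id₁₀ a b c d δ⁻¹) (trans (id₁₁ a b c d δ⁻¹) δδ⁻¹≈1)
      where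
      id₀₀ : ∀ a b c d e → d * e * a + (- b * e * c + 0#) ≈ (a * d - b * c) * e
      id₀₀ = solve 5 (λ a b c d e → d :* e :* a :+ (:- b :* e :* c :+ con (+ 0)) := (a :* d :- b :* c) :* e) refl
      id₀₁ : ∀ a b c d e → d * e * b + (- b * e * d + 0#) ≈ 0#
      id₀₁ = solve 5 (λ a b c d e → d :* e :* b :+ (:- b :* e :* d :+ con (+ 0)) := con (+ 0)) refl
      id₁₀ : ∀ a b c d e → - c * e * a + (a * e * c + 0#) ≈ 0#
      id₁₀ = solve 5 (λ a b c d e → :- c :* e :* a :+ (a :* e :* c :+ con (+ 0)) := con (+ 0)) refl
      id₁₁ : ∀ a b c d e → - c * e * b + (a * e * d + 0#) ≈ (a * d - b * c) * e
      id₁₁ = solve 5 (λ a b c d e → :- c :* e :* b :+ (a :* e :* d :+ con (+ 0)) := (a :* d :- b :* c) :* e) refl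

  distinct⇒IsUnit₁ : ∀ {x y : Mat 1} → ¬ x ≈M y → IsUnit (x -M y)
  distinct⇒IsUnit₁ {x} {y} x≉y = (λ _ _ → e) , (λ { 0F 0F → trans (+-identityʳ _) δe≈1 })
                                             , (λ { 0F 0F → trans (+-identityʳ _) (trans (*-comm _ _) δe≈1) })
    where
    δ≉0 : ¬ x 0F 0F - y 0F 0F ≈ 0#
    δ≉0 δ≈0 = x≉y (λ { 0F 0F → x-y≈0⇒x≈y δ≈0 })
    e : Carrier
    e = proj₁ (inverse _ δ≉0)
    δe≈1 : (x 0F 0F - y 0F 0F) * e ≈ 1#
    δe≈1 = proj₂ (inverse _ δ≉0)

  maximal-independent-length₁ : ∀ S → MaximalIndependent {1} S → length S ≡ 1
  maximal-independent-length₁ []           (_ , maximal) = contradiction (All.[] ∷ []) (maximal (λ _ _ → 0#))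
  maximal-independent-length₁ (_ ∷ [])     _             = ≡.refl
  maximal-independent-length₁ (_ ∷ _ ∷ _) ((((x≉y , x-y∉U) All.∷ _) ∷ _) , _) =
    contradiction (distinct⇒IsUnit₁ x≉y) x-y∉U

module DecidableFieldProperties {r ℓ : Level} (F : CommutativeRing r ℓ) (isField : IsField F)
                                (_≟_ : Decidable (CommutativeRing._≈_ F)) where
  open CommutativeRing F hiding (zero)
  open IsField isField
  open Matrices F
  open TwoByTwo F
  open SingularPlane
  open VanishingCombinations F
  open FieldProperties F isField
  open IntegerCoefficientSolver F using (solve; _:=_; _:+_; _:*_; _:-_; :-_; con)

  ¬IsUnit⇒Singular : ∀ {A} → ¬ IsUnit A → Singular A
  ¬IsUnit⇒Singular {A} ¬unit with det A ≟ 0#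
  ... | yes det≈0 = det≈0
  ... | no det≉0  = contradiction (¬Singular⇒IsUnit {A} det≉0) ¬unit

  Independent⇒PairwiseSingular : ∀ {S} → Independent S → PairwiseSingular S
  Independent⇒PairwiseSingular independent {X} {Y} X∈S Y∈S with AllPairs-∈ independent X∈S Y∈S
  ... | inj₁ ≡.refl             = Singular-sub-self X
  ... | inj₂ (inj₁ (_ , ¬unit)) = ¬IsUnit⇒Singular {X -M Y} ¬unit
  ... | inj₂ (inj₂ (_ , ¬unit)) = trans (det-sub-comm X Y) (¬IsUnit⇒Singular {Y -M X} ¬unit)

  _≟M_ : (A B : Mat 2) → Dec (A ≈M B)
  A ≟M B with A 0F 0F ≟ B 0F 0F | A 0F 1F ≟ B 0F 1F | A 1F 0F ≟ B 1F 0F | A 1F 1F ≟ B 1F 1F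
  ... | yes e₀₀ | yes e₀₁ | yes e₁₀ | yes e₁₁ = yes (≈M-from-entries e₀₀ e₀₁ e₁₀ e₁₁)
  ... | no ¬e₀₀ | _       | _       | _       = no (λ e → ¬e₀₀ (e 0F 0F))
  ... | yes _   | no ¬e₀₁ | _       | _       = no (λ e → ¬e₀₁ (e 0F 1F))
  ... | yes _   | yes _   | no ¬e₁₀ | _       = no (λ e → ¬e₁₀ (e 1F 0F))
  ... | yes _   | yes _   | yes _   | no ¬e₁₁ = no (λ e → ¬e₁₁ (e 1F 1F))

  nonzero-pivot : ∀ M → ¬ M ≈M 0M → ∃₂ λ p q → ¬ reindex p q M 0F 0F ≈ 0#
  nonzero-pivot M M≉0 with M 0F 0F ≟ 0# | M 1F 0F ≟ 0# | M 0F 1F ≟ 0# | M 1F 1F ≟ 0#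
  ... | no m₀₀≉0 | _        | _        | _        = 0F , 0F , m₀₀≉0
  ... | yes _    | no m₁₀≉0 | _        | _        = 1F , 0F , m₁₀≉0
  ... | yes _    | yes _    | no m₀₁≉0 | _        = 0F , 1F , m₀₁≉0
  ... | yes _    | yes _    | yes _    | no m₁₁≉0 = 1F , 1F , m₁₁≉0
  ... | yes m₀₀≈0 | yes m₁₀≈0 | yes m₀₁≈0 | yes m₁₁≈0 =
    contradiction (≈M-from-entries m₀₀≈0 m₀₁≈0 m₁₀≈0 m₁₁≈0) M≉0

  _∥?_ : ∀ u v → Dec (u ∥ v)
  (x , y) ∥? (a , b) = (y * a - x * b) ≟ 0#

  rowsParallel? : ∀ A X → Dec (RowsParallel A X)
  rowsParallel? A X = (row 0F X ∥? row 0F A) ×-dec (row 1F X ∥? row 0F A)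

  columnsParallel? : ∀ A X → Dec (ColumnsParallel A X)
  columnsParallel? A X = (column 0F X ∥? column 0F A) ×-dec (column 1F X ∥? column 0F A)

  RowsParallel⊎ColumnsParallel : ∀ A X → ¬ A 0F 0F ≈ 0# → Singular A → Singular X → Singular (A -M X)
                               → RowsParallel A X ⊎ ColumnsParallel A X
  RowsParallel⊎ColumnsParallel A X a≉0 A-singular X-singular A-X-singular = decide (row 0F X ∥? row 0F A)
    where
    a b c d x y z w : Carrier
    a = A 0F 0F ; b = A 0F 1F ; c = A 1F 0F ; d = A 1F 1F
    x = X 0F 0F ; y = X 0F 1F ; z = X 1F 0F ; w = X 1F 1F

    -- The first-row and first-column cross terms multiply into the ideal of det A, det X, det (A - X).
    cross-product : ∀ a b c d x y z w → (y * a - x * b) * (z * a - x * c)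
      ≈ (a * x - a * a) * (x * w - y * z) + (a * x - x * x) * (a * d - b * c)
        + (- (a * x)) * ((a - x) * (d - w) - (b - y) * (c - z))
    cross-product = solve 8 (λ a b c d x y z w → (y :* a :- x :* b) :* (z :* a :- x :* c)
      := (a :* x :- a :* a) :* (x :* w :- y :* z) :+ (a :* x :- x :* x) :* (a :* d :- b :* c)
         :+ (:- (a :* x)) :* ((a :- x) :* (d :- w) :- (b :- y) :* (c :- z))) refl

    second-row : ∀ a b c d x y z w → a * (w * a - z * b)
      ≈ (a - x) * (a * d - b * c) + a * (x * w - y * z)
        + (- a) * ((a - x) * (d - w) - (b - y) * (c - z)) + c * (y * a - x * b)
    second-row = solve 8 (λ a b c d x y z w → a :* (w :* a :- z :* b)
      := (a :- x) :* (a :* d :- b :* c) :+ a :* (x :* w :- y :* z)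
         :+ (:- a) :* ((a :- x) :* (d :- w) :- (b :- y) :* (c :- z)) :+ c :* (y :* a :- x :* b)) refl

    second-column : ∀ a b c d x y z w → a * (w * a - y * c)
      ≈ (a - x) * (a * d - b * c) + a * (x * w - y * z)
        + (- a) * ((a - x) * (d - w) - (b - y) * (c - z)) + b * (z * a - x * c)
    second-column = solve 8 (λ a b c d x y z w → a :* (w :* a :- y :* c)
      := (a :- x) :* (a :* d :- b :* c) :+ a :* (x :* w :- y :* z)
         :+ (:- a) :* ((a :- x) :* (d :- w) :- (b :- y) :* (c :- z)) :+ b :* (z :* a :- x :* c)) refl

    decide : Dec (row 0F X ∥ row 0F A) → RowsParallel A X ⊎ ColumnsParallel A X
    decide (yes first-row) = inj₁ (first-row , x*y≈0⇒y≈0 a≉0 (trans (second-row a b c d x y z w)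
      (≈0-scale A-singular +≈0 X-singular +≈0 A-X-singular +≈0 first-row)))
    decide (no ¬first-row) = inj₂ (first-column , x*y≈0⇒y≈0 a≉0 (trans (second-column a b c d x y z w)
      (≈0-scale A-singular +≈0 X-singular +≈0 A-X-singular +≈0 first-column)))
      where
      first-column : column 0F X ∥ column 0F A
      first-column = x*y≈0⇒y≈0 ¬first-row (trans (cross-product a b c d x y z w)
        (≈0-scale X-singular +≈0 A-singular +≈0 A-X-singular))

  RowsParallel-from-first-row : ∀ A X → ¬ A 0F 0F ≈ 0# → ColumnsParallel A X
                              → row 0F X ∥ row 0F A → RowsParallel A X
  RowsParallel-from-first-row A X a≉0 (first-column , second-column) first-row =
    first-row , x*y≈0⇒y≈0 a≉0 (trans (identity (A 0F 0F) (A 0F 1F) (A 1F 0F) (X 0F 0F) (X 0F 1F) (X 1F 0F) (X 1F 1F))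
      (≈0-scale first-row +≈0 second-column +≈0 first-column))
    where
    identity : ∀ a b c x y z w → a * (w * a - z * b) ≈ c * (y * a - x * b) + a * (w * a - y * c) + (- b) * (z * a - x * c)
    identity = solve 7 (λ a b c x y z w → a :* (w :* a :- z :* b)
      := c :* (y :* a :- x :* b) :+ a :* (w :* a :- y :* c) :+ (:- b) :* (z :* a :- x :* c)) refl

  ColumnsParallel-from-first-column : ∀ A X → ¬ A 0F 0F ≈ 0# → RowsParallel A X
                                    → column 0F X ∥ column 0F A → ColumnsParallel A X
  ColumnsParallel-from-first-column A X a≉0 (first-row , second-row) first-column =
    first-column , x*y≈0⇒y≈0 a≉0 (trans (identity (A 0F 0F) (A 0F 1F) (A 1F 0F) (X 0F 0F) (X 0F 1F) (X 1F 0F) (X 1F 1F))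
      (≈0-scale first-column +≈0 second-row +≈0 first-row))
    where
    identity : ∀ a b c x y z w → a * (w * a - y * c) ≈ b * (z * a - x * c) + a * (w * a - z * b) + (- c) * (y * a - x * b)
    identity = solve 7 (λ a b c x y z w → a :* (w :* a :- y :* c)
      := b :* (z :* a :- x :* c) :+ a :* (w :* a :- z :* b) :+ (:- c) :* (y :* a :- x :* b)) refl

  ¬Singular-columns-sub-rows : ∀ A X Y → ¬ A 0F 0F ≈ 0#
    → ColumnsParallel A X → ¬ RowsParallel A X → RowsParallel A Y → ¬ ColumnsParallel A Y
    → ¬ Singular (X -M Y)
  ¬Singular-columns-sub-rows A X Y a≉0 X-columns@(X-first-column , X-second-column) ¬X-rows
                                       Y-rows@(Y-first-row , Y-second-row) ¬Y-columns X-Y-singular =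
    x≉0∧y≉0⇒x*y≉0 ¬X-first-row ¬Y-first-column
      (trans (cross-product a b c x y z w x′ y′ z′ w′)
        (≈0-scale X-Y-singular +≈0 X-second-column +≈0 Y-second-row +≈0 X-first-column +≈0 Y-first-row))
    where
    a b c x y z w x′ y′ z′ w′ : Carrier
    a = A 0F 0F ; b = A 0F 1F ; c = A 1F 0F
    x = X 0F 0F ; y = X 0F 1F ; z = X 1F 0F ; w = X 1F 1F
    x′ = Y 0F 0F ; y′ = Y 0F 1F ; z′ = Y 1F 0F ; w′ = Y 1F 1F

    ¬X-first-row : ¬ row 0F X ∥ row 0F A
    ¬X-first-row = ¬X-rows ∘ RowsParallel-from-first-row A X a≉0 X-columns

    ¬Y-first-column : ¬ column 0F Y ∥ column 0F A
    ¬Y-first-column = ¬Y-columns ∘ ColumnsParallel-from-first-column A Y a≉0 Y-rows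

    -- Neither cross term vanishes, yet their product lies in the ideal of det (X - Y) and
    -- the four parallelism relations.
    cross-product : ∀ a b c x y z w x′ y′ z′ w′ → (y * a - x * b) * (z′ * a - x′ * c)
      ≈ (a * a) * ((x - x′) * (w - w′) - (y - y′) * (z - z′)) + (- (a * (x - x′))) * (w * a - y * c)
        + (a * (x - x′)) * (w′ * a - z′ * b) + (a * y - x′ * b) * (z * a - x * c)
        + (- (a * z - a * z′)) * (y′ * a - x′ * b)
    cross-product = solve 11 (λ a b c x y z w x′ y′ z′ w′ → (y :* a :- x :* b) :* (z′ :* a :- x′ :* c)
      := (a :* a) :* ((x :- x′) :* (w :- w′) :- (y :- y′) :* (z :- z′)) :+ (:- (a :* (x :- x′))) :* (w :* a :- y :* c)
         :+ (a :* (x :- x′)) :* (w′ :* a :- z′ :* b) :+ (a :* y :- x′ :* b) :* (z :* a :- x :* c)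
         :+ (:- (a :* z :- a :* z′)) :* (y′ :* a :- x′ :* b)) refl

  InPlane-pivoted : ∀ {A T} → A ∈ T → ¬ A 0F 0F ≈ 0# → AllSingular T → PairwiseSingular T → InPlane T
  InPlane-pivoted {A} {T} A∈T a≉0 singular pairwise = choose (all? (rowsParallel? A) T)
    where
    e : Carrier
    e = proj₁ (inverse _ a≉0)
    ae≈1 : A 0F 0F * e ≈ 1#
    ae≈1 = proj₂ (inverse _ a≉0)

    dichotomy : ∀ {X} → X ∈ T → RowsParallel A X ⊎ ColumnsParallel A X
    dichotomy {X} X∈T = RowsParallel⊎ColumnsParallel A X a≉0 (singular A∈T) (singular X∈T) (pairwise A∈T X∈T)

    choose : Dec (All (RowsParallel A) T) → InPlane T
    choose (yes rows) = rowPlane (A 0F 1F * e) , λ {X} X∈T → RowsParallel⇒Contains A X ae≈1 (All.lookup rows X∈T)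
    choose (no ¬rows) = columnPlane (A 1F 0F * e) , λ {X} X∈T → ColumnsParallel⇒Contains A X ae≈1 (columns X∈T)
      where
      witness : ∃ λ X₂ → X₂ ∈ T × ¬ RowsParallel A X₂
      witness = find (¬All⇒Any¬ (rowsParallel? A) T ¬rows)
      X₂ : Mat 2
      X₂ = proj₁ witness
      X₂∈T : X₂ ∈ T
      X₂∈T = proj₁ (proj₂ witness)
      ¬X₂-rows : ¬ RowsParallel A X₂
      ¬X₂-rows = proj₂ (proj₂ witness)

      X₂-columns : ColumnsParallel A X₂
      X₂-columns with dichotomy X₂∈T
      ... | inj₁ X₂-rows    = contradiction X₂-rows ¬X₂-rows
      ... | inj₂ X₂-columns = X₂-columns

      columns : ∀ {X} → X ∈ T → ColumnsParallel A X
      columns {X} X∈T with dichotomy X∈T | columnsParallel? A X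
      ... | _              | yes X-columns = X-columns
      ... | inj₂ X-columns | no ¬X-columns = contradiction X-columns ¬X-columns
      ... | inj₁ X-rows    | no ¬X-columns = contradiction (pairwise X₂∈T X∈T)
          (¬Singular-columns-sub-rows A X₂ X a≉0 X₂-columns ¬X₂-rows X-rows ¬X-columns)

  singular-family-InPlane : ∀ T → AllSingular T → PairwiseSingular T → InPlane T
  singular-family-InPlane T singular pairwise = choose (all? (_≟M 0M) T)
    where
    choose : Dec (All (_≈M 0M) T) → InPlane T
    choose (yes zeros) = rowPlane 0# , λ X∈T → ≈0M⇒Contains (All.lookup zeros X∈T)
    choose (no ¬zeros) = reindexPlane p q P , λ X∈T → Contains-reindexPlane p q P (in-P (∈-map⁺ (reindex p q) X∈T))
      where
      witness : ∃ λ X₁ → X₁ ∈ T × ¬ X₁ ≈M 0M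
      witness = find (¬All⇒Any¬ (_≟M 0M) T ¬zeros)
      X₁ : Mat 2
      X₁ = proj₁ witness
      X₁∈T : X₁ ∈ T
      X₁∈T = proj₁ (proj₂ witness)

      pivot : ∃₂ λ p q → ¬ reindex p q X₁ 0F 0F ≈ 0#
      pivot = nonzero-pivot X₁ (proj₂ (proj₂ witness))
      p q : Fin 2
      p = proj₁ pivot
      q = proj₁ (proj₂ pivot)

      reindexed-InPlane : InPlane (map (reindex p q) T)
      reindexed-InPlane = InPlane-pivoted (∈-map⁺ (reindex p q) X₁∈T) (proj₂ (proj₂ pivot))
        (AllSingular-reindex p q singular) (PairwiseSingular-reindex p q pairwise)
      P : SingularPlane
      P = proj₁ reindexed-InPlane
      in-P : ∀ {X} → X ∈ map (reindex p q) T → Contains P X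
      in-P = proj₂ reindexed-InPlane

  Maximal⇒coordinates-cover : ∀ P s₀ {S} → (∀ {x} → x ∈ S → Contains P (x -M s₀))
    → Independent S → (∀ v → ¬ Independent (v ∷ S)) → ∀ u → u ∈₂ map (coordinates P s₀) S
  Maximal⇒coordinates-cover P s₀ {S} contains independent maximal u = choose (any? (v ≟M_) S)
    where
    v : Mat 2
    v i j = s₀ i j + point P u i j

    v-s₀≈u : (v -M s₀) ≈M point P u
    v-s₀≈u i j = identity (s₀ i j) (point P u i j)
      where
      identity : ∀ a p → (a + p) - a ≈ p
      identity = solve 2 (λ a p → (a :+ p) :- a := p) refl

    v-x≈u-x : ∀ x → (v -M x) ≈M (point P u -M (x -M s₀))
    v-x≈u-x x i j = identity (s₀ i j) (point P u i j) (x i j)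
      where
      identity : ∀ a p x → (a + p) - x ≈ p - (x - a)
      identity = solve 3 (λ a p x → (a :+ p) :- x := p :- (x :- a)) refl

    choose : Dec (Any (v ≈M_) S) → u ∈₂ map (coordinates P s₀) S
    choose (yes v∈S) = Any.map⁺ (Any.map (λ v≈x → ≈₂-sym (≈₂-trans
      (coords-cong P (≈M-trans (-M-cong (≈M-sym v≈x) (λ _ _ → refl)) v-s₀≈u)) (coords-point P u))) v∈S)
    choose (no v∉S) = contradiction (All.tabulate v-independent ∷ independent) (maximal v)
      where
      v-independent : ∀ {x} → x ∈ S → ¬ v ≈M x × ¬ IsUnit (v -M x)
      v-independent {x} x∈S = (λ v≈x → v∉S (lose x∈S v≈x)) , λ unit → IsUnit⇒¬Singular {v -M x} unit
        (trans (det-cong (≈M-trans (v-x≈u-x x) (-M-cong (λ _ _ → refl) (contains x∈S))))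
               (point-sub-singular P u (coords P (x -M s₀))))

module FiniteFieldProperties {r ℓ : Level} (F : CommutativeRing r ℓ) (isField : IsField F)
                             (isFinite : IsFinite F) where
  open CommutativeRing F hiding (zero)
  open IsFinite isFinite
  open Matrices F
  open TwoByTwo F
  open SingularPlane

  index-injective : ∀ {x y} → index x ≡ index y → x ≈ y
  index-injective {x} {y} e = trans (sym (enum-index x)) (trans (reflexive (≡.cong enum e)) (enum-index y))

  enum-injective : ∀ {i j} → enum i ≈ enum j → i ≡ j
  enum-injective {i} {j} e = ≡.trans (≡.sym (index-enum i)) (≡.trans (index-cong e) (index-enum j))

  _≟_ : Decidable _≈_
  x ≟ y with index x Fin.≟ index y
  ... | yes e = yes (index-injective e)
  ... | no ¬e = no (λ x≈y → ¬e (index-cong x≈y))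

  open DecidableFieldProperties F isField _≟_

  length-unique-cover-coordinates : ∀ {us} → Unique us → (∀ u → u ∈₂ us) → length us ≡ size ℕ.* size
  length-unique-cover-coordinates = length-unique-cover Coordinates code decode code-injective decode-injective
    where
    code : Carrier × Carrier → Fin (size ℕ.* size)
    code (s , t) = combine (index s) (index t)
    decode : Fin (size ℕ.* size) → Carrier × Carrier
    decode k = enum (proj₁ (remQuot {size} size k)) , enum (proj₂ (remQuot {size} size k))
    code-injective : ∀ {u v} → code u ≡ code v → u ≈₂ v
    code-injective e = let i≡k , j≡l = combine-injective _ _ _ _ e in index-injective i≡k , index-injective j≡l
    decode-injective : ∀ {k l} → decode k ≈₂ decode l → k ≡ l
    decode-injective {k} {l} (e₁ , e₂) = ≡.trans (≡.sym (combine-remQuot {size} size k))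
      (≡.trans (≡.cong₂ combine (enum-injective e₁) (enum-injective e₂)) (combine-remQuot {size} size l))

  maximal-independent-length₂ : ∀ S → MaximalIndependent {2} S → length S ≡ size ℕ.* size
  maximal-independent-length₂ []         (_ , maximal)           = contradiction (All.[] ∷ []) (maximal 0M)
  maximal-independent-length₂ S@(s₀ ∷ _) (independent , maximal) = begin
    length S                            ≡⟨ length-map (coordinates P s₀) S ⟨
    length (map (coordinates P s₀) S)   ≡⟨ length-unique-cover-coordinates
                                             (Independent⇒Unique-coordinates P s₀ contains independent)
                                             (Maximal⇒coordinates-cover P s₀ contains independent maximal) ⟩
    size ℕ.* size                       ∎
    where
    open ≡.≡-Reasoning
    pairwise : PairwiseSingular S
    pairwise = Independent⇒PairwiseSingular independent

    translated-InPlane : InPlane (map (_-M s₀) S)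
    translated-InPlane = singular-family-InPlane (map (_-M s₀) S)
      (AllSingular-translate (here ≡.refl) pairwise) (PairwiseSingular-translate s₀ pairwise)

    P : SingularPlane
    P = proj₁ translated-InPlane

    contains : ∀ {x} → x ∈ S → Contains P (x -M s₀)
    contains x∈S = proj₂ translated-InPlane (∈-map⁺ (_-M s₀) x∈S)

proposition2p1 : ∀ {c ℓ : Level} (F : CommutativeRing c ℓ) → IsField F → IsFinite F
    → (n : ℕ) → 1 ≤ n → n ≤ 2 → Matrices.WellCovered F n
proposition2p1 F isField isFinite 1 _ _ S T S-maximal T-maximal =
  ≡.trans (maximal-independent-length₁ S S-maximal) (≡.sym (maximal-independent-length₁ T T-maximal))
  where open FieldProperties F isField
proposition2p1 F isField isFinite 2 _ _ S T S-maximal T-maximal =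
  ≡.trans (maximal-independent-length₂ S S-maximal) (≡.sym (maximal-independent-length₂ T T-maximal))
  where open FiniteFieldProperties F isField isFinite
proposition2p1 F isField isFinite (suc (suc (suc _))) _ (s≤s (s≤s ()))
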